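{- Let $q$ be a prime power and let $H$ be a nonempty set of (affine) hyperplanes in $\mathbb{F}_q^d$. Let $E = \bigcup_{h \in H} h$. Then $|\mathbb{F}_q^d \setminus E| \leq \frac{q^{d+1}}{|H|}$.
   Context: A hyperplane in $\mathbb{F}_q^d$ means a translate of a $(d-1)$-dimensional linear subspace. -}

module Defs where

open import Level using (Level; _⊔_; suc)
open import Algebra.Bundles using (CommutativeRing)
open import Data.Nat as ℕ using (ℕ)
open import Data.Fin using (Fin)
open import Data.Vec using (Vec; []; _∷_; zipWith; foldr)
open import Data.List as List using (List; length; filter; concatMap; map; tabulate)
open import Data.List.Relation.Unary.Any using (any?)
open import Data.List.Relation.Unary.AllPairs using (AllPairs)
open import Data.Vec.Relation.Unary.All using (All)
open import Data.Product using (Σ; ∃; _×_; _,_)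
open import Relation.Nullary using (¬_; Dec; ¬?)
open import Relation.Binary.PropositionalEquality using (_≡_)
open import Relation.Binary.Definitions using (Decidable)

-- A finite field with exactly q elements.
-- (Every finite field has prime-power order, and for every prime power q
--  such a field exists, so quantifying over these is the same as
--  "q a prime power, F = F_q".)
record FiniteField (c ℓ : Level) (q : ℕ) : Set (Level.suc (c ⊔ ℓ)) where
  field
    commRing : CommutativeRing c ℓ
  open CommutativeRing commRing public
  field
    0#≉1#   : ¬ (0# ≈ 1#)
    inverse : ∀ x → ¬ (x ≈ 0#) → ∃ λ y → (x * y) ≈ 1#
    _≟_     : Decidable _≈_
    enum      : Fin q → Carrier
    enum-surj : ∀ x → ∃ λ i → enum i ≈ x
    enum-inj  : ∀ i j → enum i ≈ enum j → i ≡ j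

module _ {c ℓ : Level} {q : ℕ} (F : FiniteField c ℓ q) where
  open FiniteField F

  elems : List Carrier
  elems = tabulate enum

  points : (d : ℕ) → List (Vec Carrier d)
  points ℕ.zero    = [] List.∷ List.[]
  points (ℕ.suc d) = concatMap (λ x → map (x ∷_) (points d)) elems

  dot : ∀ {d} → Vec Carrier d → Vec Carrier d → Carrier
  dot a x = foldr _ _+_ 0# (zipWith _*_ a x)

  record Hyperplane (d : ℕ) : Set (c ⊔ ℓ) where
    constructor hyp
    field
      normal    : Vec Carrier d
      normal≢0  : ¬ All (λ z → z ≈ 0#) normal
      offset    : Carrier

  _∈H_ : ∀ {d} → Vec Carrier d → Hyperplane d → Set ℓ
  x ∈H h = dot (Hyperplane.normal h) x ≈ Hyperplane.offset h

  _∈H?_ : ∀ {d} (x : Vec Carrier d) (h : Hyperplane d) → Dec (x ∈H h)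
  x ∈H? h = dot (Hyperplane.normal h) x ≟ Hyperplane.offset h

  SameHyperplane : ∀ {d} → Hyperplane d → Hyperplane d → Set (c ⊔ ℓ)
  SameHyperplane {d} h h' = ∀ (x : Vec Carrier d) → (x ∈H h → x ∈H h') × (x ∈H h' → x ∈H h)

  -- a finite set of hyperplanes: a list of pairwise distinct hyperplanes
  DistinctHyperplanes : ∀ {d} → List (Hyperplane d) → Set (c ⊔ ℓ)
  DistinctHyperplanes H = AllPairs (λ h h' → ¬ SameHyperplane h h') H

  uncovered : ∀ {d} → List (Hyperplane d) → ℕ
  uncovered {d} H = length (filter (λ x → ¬? (any? (x ∈H?_) H)) (points d))

module Submission where

-- Proof by the second moment method.  Let f(y) be the number of hyperplanes of H
-- through y and n = |H|.  A hyperplane has q^(d-1) points and two distinct hyperplanes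
-- share at most q^(d-2), hence
--     q · ∑_y f(y) = n·q^d     and     q² · ∑_y f(y)² ≤ n·q^(d+1) + n²·q^d.
-- Since f vanishes exactly off ⋃H and 2nq·f ≤ q²f² + n² (AM–GM), summing over all y
-- gives |F^d ∖ ⋃H|·n² ≤ n·q^(d+1).

open import Defs
open import Level using (Level; _⊔_)
open import Function using (_∘_; _⇔_; mk⇔; Equivalence)
open import Data.Empty using (⊥-elim)
open import Data.Nat using (ℕ; NonZero)
import Data.Nat.Properties as ℕ
open import Data.Fin using (Fin) renaming (zero to fzero; suc to fsuc)
import Data.Fin.Properties as Fin
open import Data.Sum using (inj₁; inj₂)
open import Data.Product using (_×_; _,_; proj₁; proj₂)
open import Data.Vec using (Vec; []; _∷_; zipWith)
open import Data.Vec.Relation.Unary.All using ([]; _∷_) renaming (All to VAll)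
open import Data.List using (List; []; _∷_; length; filter; concatMap; map; tabulate; _++_)
import Data.List.Properties as List
open import Data.List.Relation.Unary.All as All using (All; []; _∷_)
open import Data.List.Relation.Unary.All.Properties using (tabulate⁺; ¬Any⇒All¬)
open import Data.List.Relation.Unary.AllPairs using (AllPairs; []; _∷_)
open import Relation.Nullary using (¬_; Dec; yes; no; ¬?)
open import Relation.Unary using (Pred)
open import Relation.Binary.PropositionalEquality as ≡ using (_≡_)

module Counting where

  open import Data.Nat using (zero; suc; _+_; _*_; _≤_; z≤n)
  open import Data.Nat.Tactic.RingSolver using (solve-∀)
  open ≡ using (refl; cong; cong₂)

  module _ {a} {A : Set a} where

    ∑ : List A → (A → ℕ) → ℕ
    ∑ []       f = 0
    ∑ (x ∷ xs) f = f x + ∑ xs f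

    syntax ∑ L (λ x → e) = ∑[ x ∈ L ] e

    ∑-cong : ∀ (L : List A) {f g : A → ℕ} → (∀ x → f x ≡ g x) → ∑ L f ≡ ∑ L g
    ∑-cong []      f≡g = refl
    ∑-cong (x ∷ L) f≡g = cong₂ _+_ (f≡g x) (∑-cong L f≡g)

    ∑-mono : ∀ (L : List A) {f g : A → ℕ} → (∀ x → f x ≤ g x) → ∑ L f ≤ ∑ L g
    ∑-mono []      f≤g = z≤n
    ∑-mono (x ∷ L) f≤g = ℕ.+-mono-≤ (f≤g x) (∑-mono L f≤g)

    ∑-bounded : ∀ (L : List A) {f : A → ℕ} {k : ℕ} → All (λ x → f x ≤ k) L → ∑ L f ≤ length L * k
    ∑-bounded []      []         = z≤n
    ∑-bounded (x ∷ L) (fx≤k ∷ p) = ℕ.+-mono-≤ fx≤k (∑-bounded L p)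

    ∑-const : ∀ (L : List A) (k : ℕ) → ∑[ _ ∈ L ] k ≡ length L * k
    ∑-const []      k = refl
    ∑-const (x ∷ L) k = cong (k +_) (∑-const L k)

    ∑-distrib-+ : ∀ (L : List A) (f g : A → ℕ) → ∑[ x ∈ L ] (f x + g x) ≡ ∑ L f + ∑ L g
    ∑-distrib-+ []      f g = refl
    ∑-distrib-+ (x ∷ L) f g = ≡.trans (cong (f x + g x +_) (∑-distrib-+ L f g)) (shuffle (f x) (g x) _ _)
      where
      shuffle : ∀ a b c d → (a + b) + (c + d) ≡ (a + c) + (b + d)
      shuffle = solve-∀

    ∑-*ˡ : ∀ (L : List A) (k : ℕ) (f : A → ℕ) → ∑[ x ∈ L ] (k * f x) ≡ k * ∑ L f
    ∑-*ˡ []      k f = ≡.sym (ℕ.*-zeroʳ k)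
    ∑-*ˡ (x ∷ L) k f = ≡.trans (cong (k * f x +_) (∑-*ˡ L k f)) (≡.sym (ℕ.*-distribˡ-+ k (f x) (∑ L f)))

    ∑-*ʳ : ∀ (L : List A) (k : ℕ) (f : A → ℕ) → ∑[ x ∈ L ] (f x * k) ≡ ∑ L f * k
    ∑-*ʳ L k f = ≡.trans (∑-cong L (λ x → ℕ.*-comm (f x) k)) (≡.trans (∑-*ˡ L k f) (ℕ.*-comm k (∑ L f)))

    ∑-++ : ∀ (L M : List A) (f : A → ℕ) → ∑ (L ++ M) f ≡ ∑ L f + ∑ M f
    ∑-++ []      M f = refl
    ∑-++ (x ∷ L) M f = ≡.trans (cong (f x +_) (∑-++ L M f)) (≡.sym (ℕ.+-assoc (f x) (∑ L f) (∑ M f)))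

  module _ {a b} {A : Set a} {B : Set b} where

    ∑-map : ∀ (L : List A) (h : A → B) (f : B → ℕ) → ∑ (map h L) f ≡ ∑[ x ∈ L ] f (h x)
    ∑-map []      h f = refl
    ∑-map (x ∷ L) h f = cong (f (h x) +_) (∑-map L h f)

    ∑-concatMap : ∀ (L : List A) (h : A → List B) (f : B → ℕ) →
                  ∑ (concatMap h L) f ≡ ∑[ x ∈ L ] ∑ (h x) f
    ∑-concatMap []      h f = refl
    ∑-concatMap (x ∷ L) h f = ≡.trans (∑-++ (h x) (concatMap h L) f) (cong (∑ (h x) f +_) (∑-concatMap L h f))

    ∑-swap : ∀ (L : List A) (M : List B) (f : A → B → ℕ) →
             ∑[ x ∈ L ] ∑[ y ∈ M ] f x y ≡ ∑[ y ∈ M ] ∑[ x ∈ L ] f x y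
    ∑-swap []      M f = ≡.sym (≡.trans (∑-const M 0) (ℕ.*-zeroʳ (length M)))
    ∑-swap (x ∷ L) M f = ≡.trans (cong (∑[ y ∈ M ] f x y +_) (∑-swap L M f))
                                 (≡.sym (∑-distrib-+ M (f x) (λ y → ∑[ x ∈ L ] f x y)))

    ∑-square : ∀ (P : List A) (H : List B) (I : B → A → ℕ) →
               ∑[ y ∈ P ] ((∑[ h ∈ H ] I h y) * (∑[ h ∈ H ] I h y)) ≡ ∑[ h ∈ H ] ∑[ h' ∈ H ] ∑[ y ∈ P ] (I h y * I h' y)
    ∑-square P H I = ≡.trans (∑-cong P expand)
                    (≡.trans (∑-swap P H _) (∑-cong H (λ h → ∑-swap P H (λ y h' → I h y * I h' y))))
      where
      expand : ∀ y → (∑[ h ∈ H ] I h y) * (∑[ h ∈ H ] I h y) ≡ ∑[ h ∈ H ] ∑[ h' ∈ H ] (I h y * I h' y)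
      expand y = ≡.trans (≡.sym (∑-*ʳ H _ (λ h → I h y)))
                         (∑-cong H (λ h → ≡.sym (∑-*ˡ H (I h y) (λ h' → I h' y))))

  𝟙 : ∀ {p} {P : Set p} → Dec P → ℕ
  𝟙 (yes _) = 1
  𝟙 (no _)  = 0

  module _ {r s} {R : Set r} {S : Set s} where

    𝟙-⇔ : (R? : Dec R) (S? : Dec S) → R ⇔ S → 𝟙 R? ≡ 𝟙 S?
    𝟙-⇔ (yes _) (yes _) R⇔S = refl
    𝟙-⇔ (yes r) (no ¬s) R⇔S = ⊥-elim (¬s (Equivalence.to R⇔S r))
    𝟙-⇔ (no ¬r) (yes s) R⇔S = ⊥-elim (¬r (Equivalence.from R⇔S s))
    𝟙-⇔ (no _)  (no _)  R⇔S = refl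

  module _ {p r s} {P : Set p} {R : Set r} {S : Set s} where

    𝟙-*-cong : (P? : Dec P) (R? : Dec R) (S? : Dec S) → (P → R ⇔ S) → 𝟙 P? * 𝟙 R? ≡ 𝟙 P? * 𝟙 S?
    𝟙-*-cong (yes p) R? S? P⇒R⇔S = cong (1 *_) (𝟙-⇔ R? S? (P⇒R⇔S p))
    𝟙-*-cong (no _)  R? S? P⇒R⇔S = refl

  𝟙-idem : ∀ {p} {P : Set p} (P? : Dec P) → 𝟙 P? * 𝟙 P? ≡ 𝟙 P?
  𝟙-idem (yes _) = refl
  𝟙-idem (no _)  = refl

  module _ {a p} {A : Set a} {P : Pred A p} (P? : ∀ x → Dec (P x)) where

    count : List A → ℕ
    count L = ∑[ x ∈ L ] 𝟙 (P? x)

    length-filter : ∀ (L : List A) → length (filter P? L) ≡ count L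
    length-filter []      = refl
    length-filter (x ∷ L) with P? x
    ... | yes _ = cong suc (length-filter L)
    ... | no _  = length-filter L

    count-none : ∀ {L : List A} → All (¬_ ∘ P) L → count L ≡ 0
    count-none {[]}    []         = refl
    count-none {x ∷ L} (¬px ∷ ps) with P? x
    ... | yes px = ⊥-elim (¬px px)
    ... | no _   = count-none ps

    count-tabulate-unique : ∀ {n} (f : Fin n → A) (i : Fin n) → P (f i) →
                            (∀ j → P (f j) → j ≡ i) → count (tabulate f) ≡ 1
    count-tabulate-unique f fzero pi only-i with P? (f fzero)
    ... | yes _  = cong suc (count-none (tabulate⁺ (λ j pj → Fin.0≢1+n (≡.sym (only-i (fsuc j) pj)))))
    ... | no ¬pi = ⊥-elim (¬pi pi)
    count-tabulate-unique f (fsuc i) pi only-i with P? (f fzero)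
    ... | yes p0 = ⊥-elim (Fin.0≢1+n (only-i fzero p0))
    ... | no _   = count-tabulate-unique (f ∘ fsuc) i pi (λ j pj → Fin.suc-injective (only-i (fsuc j) pj))

  -- The arithmetic–geometric mean inequality 2ab ≤ a² + b² in ℕ, first for a ≤ b,
  -- where it is the identity a² + b² = 2ab + (b - a)².
  am-gm-ordered : ∀ {a b} → a ≤ b → 2 * (a * b) ≤ a * a + b * b
  am-gm-ordered {a} a≤b with ℕ.m≤n⇒∃[o]m+o≡n a≤b
  ... | k , refl = ℕ.≤-trans (ℕ.m≤m+n _ (k * k)) (ℕ.≤-reflexive (square-gap a k))
    where
    square-gap : ∀ a k → 2 * (a * (a + k)) + k * k ≡ a * a + (a + k) * (a + k)
    square-gap = solve-∀

  am-gm : ∀ a b → 2 * (a * b) ≤ a * a + b * b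
  am-gm a b with ℕ.≤-total a b
  ... | inj₁ a≤b = am-gm-ordered a≤b
  ... | inj₂ b≤a = ≡.subst₂ _≤_ (cong (2 *_) (ℕ.*-comm b a)) (ℕ.+-comm (b * b) (a * a)) (am-gm-ordered b≤a)

  -- Let f : A → ℕ be a count function on a list P of N points
  -- with first moment q·∑f = nN and second moment q²·∑f² ≤ nqN + n²N, and let Z be a
  -- property forcing f = 0.  Then Z holds at no more than qN/n points of P.
  -- Pointwise, [Z y]·n² + 2nq·f y ≤ q²·(f y)² + n² (by AM–GM where f y may be positive);
  -- summing over P and inserting the moments leaves [#Z]·n² ≤ nqN.
  module _ {a z} {A : Set a} {Z : Pred A z} (Z? : ∀ x → Dec (Z x)) where

    second-moment : ∀ (P : List A) (f : A → ℕ) (n q : ℕ) .{{_ : NonZero n}} →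
                    (∀ y → Z y → f y ≡ 0) →
                    q * ∑ P f ≡ n * length P →
                    q * q * ∑[ y ∈ P ] (f y * f y) ≤ n * (q * length P) + n * n * length P →
                    count Z? P * n ≤ q * length P
    second-moment P f n q Z⇒f≡0 first second =
      ℕ.*-cancelʳ-≤ (count Z? P * n) (q * N) n
        (≡.subst₂ _≤_ (≡.sym (ℕ.*-assoc (count Z? P) n n)) (ℕ.*-comm n (q * N))
          (ℕ.+-cancelʳ-≤ (2 * n * (n * N)) _ _ summed))
      where
      open ℕ.≤-Reasoning
      N = length P

      pointwise : ∀ y → 𝟙 (Z? y) * (n * n) + 2 * n * (q * f y) ≤ q * q * (f y * f y) + n * n
      pointwise y with Z? y
      ... | yes zy rewrite Z⇒f≡0 y zy = ℕ.≤-reflexive (vanishing n q)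
        where
        vanishing : ∀ n q → 1 * (n * n) + 2 * n * (q * 0) ≡ q * q * (0 * 0) + n * n
        vanishing = solve-∀
      ... | no _ = ≡.subst₂ _≤_ (lhs n (q * f y)) (rhs n q (f y)) (am-gm n (q * f y))
        where
        lhs : ∀ n t → 2 * (n * t) ≡ 0 * (n * n) + 2 * n * t
        lhs = solve-∀
        rhs : ∀ n q t → n * n + q * t * (q * t) ≡ q * q * (t * t) + n * n
        rhs = solve-∀

      sum-lhs : ∑[ y ∈ P ] (𝟙 (Z? y) * (n * n) + 2 * n * (q * f y)) ≡ count Z? P * (n * n) + 2 * n * (q * ∑ P f)
      sum-lhs = ≡.trans (∑-distrib-+ P _ _)
                  (cong₂ _+_ (∑-*ʳ P (n * n) _)
                             (≡.trans (∑-*ˡ P (2 * n) _) (cong (2 * n *_) (∑-*ˡ P q f))))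

      sum-rhs : ∑[ y ∈ P ] (q * q * (f y * f y) + n * n) ≡ q * q * ∑[ y ∈ P ] (f y * f y) + N * (n * n)
      sum-rhs = ≡.trans (∑-distrib-+ P _ _) (cong₂ _+_ (∑-*ˡ P (q * q) _) (∑-const P (n * n)))

      collect : ∀ n q N → n * (q * N) + n * n * N + N * (n * n) ≡ n * (q * N) + 2 * n * (n * N)
      collect = solve-∀

      summed : count Z? P * (n * n) + 2 * n * (n * N) ≤ n * (q * N) + 2 * n * (n * N)
      summed = begin
        count Z? P * (n * n) + 2 * n * (n * N)         ≡⟨ cong (λ t → count Z? P * (n * n) + 2 * n * t) first ⟨
        count Z? P * (n * n) + 2 * n * (q * ∑ P f)     ≡⟨ sum-lhs ⟨
        ∑[ y ∈ P ] (𝟙 (Z? y) * (n * n) + 2 * n * (q * f y)) ≤⟨ ∑-mono P pointwise ⟩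
        ∑[ y ∈ P ] (q * q * (f y * f y) + n * n)       ≡⟨ sum-rhs ⟩
        q * q * ∑[ y ∈ P ] (f y * f y) + N * (n * n)   ≤⟨ ℕ.+-monoˡ-≤ (N * (n * n)) second ⟩
        n * (q * N) + n * n * N + N * (n * n)          ≡⟨ collect n q N ⟩
        n * (q * N) + 2 * n * (n * N)                  ∎

  module _ {a r} {A : Set a} {R : A → A → Set r} (g : A → A → ℕ) {α β : ℕ} where

    ∑∑-bound : (∀ x → g x x ≤ α) → (∀ x y → R x y → g x y ≤ β) → (∀ x y → R x y → g y x ≤ β) →
               ∀ {L} → AllPairs R L → ∑[ x ∈ L ] ∑[ y ∈ L ] g x y ≤ length L * α + length L * length L * β
    ∑∑-bound diag off off' {[]}    []        = z≤n
    ∑∑-bound diag off off' {x ∷ L} (Rx ∷ Rs) = begin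
      (g x x + ∑[ y ∈ L ] g x y) + ∑[ x' ∈ L ] (g x' x + ∑[ y ∈ L ] g x' y)
        ≡⟨ cong (g x x + ∑[ y ∈ L ] g x y +_) (∑-distrib-+ L (λ x' → g x' x) (λ x' → ∑[ y ∈ L ] g x' y)) ⟩
      (g x x + ∑[ y ∈ L ] g x y) + (∑[ x' ∈ L ] g x' x + ∑[ x' ∈ L ] ∑[ y ∈ L ] g x' y)
        ≤⟨ ℕ.+-mono-≤ (ℕ.+-mono-≤ (diag x) (∑-bounded L (All.map (λ {y} → off x y) Rx)))
                      (ℕ.+-mono-≤ (∑-bounded L (All.map (λ {y} → off' x y) Rx)) (∑∑-bound diag off off' Rs)) ⟩
      (α + m * β) + (m * β + (m * α + m * m * β))
        ≤⟨ ℕ.m≤m+n _ β ⟩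
      (α + m * β) + (m * β + (m * α + m * m * β)) + β
        ≡⟨ expand α β m ⟩
      suc m * α + suc m * suc m * β ∎
      where
      open ℕ.≤-Reasoning
      m = length L
      expand : ∀ α β m → (α + m * β) + (m * β + (m * α + m * m * β)) + β ≡ suc m * α + suc m * suc m * β
      expand = solve-∀

module FieldAlgebra {c ℓ : Level} {q : ℕ} (F : FiniteField c ℓ q) where

  open FiniteField F
  open import Algebra.Properties.Ring ring
    using (x∙y⁻¹≈ε⇒x≈y; x≈y⇒x∙y⁻¹≈ε; x≈z//y; //-rightDividesˡ; +-cancelʳ; -‿+-comm; -‿distribˡ-*)
  open import Algebra.Properties.CommutativeSemigroup +-commutativeSemigroup using (interchange)
  open import Relation.Binary.Reasoning.Setoid setoid

  Sol : ∀ {d} → Vec Carrier d → Carrier → Vec Carrier d → Set ℓ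
  Sol a b x = dot F a x ≈ b

  SameSol : ∀ {d} → Vec Carrier d → Carrier → Vec Carrier d → Carrier → Set (c ⊔ ℓ)
  SameSol {d} a b a' b' = ∀ (x : Vec Carrier d) → (Sol a b x → Sol a' b' x) × (Sol a' b' x → Sol a b x)

  SameSol-sym : ∀ {d} (a : Vec Carrier d) b a' b' → SameSol a b a' b' → SameSol a' b' a b
  SameSol-sym a b a' b' same x = proj₂ (same x) , proj₁ (same x)

  IsZeroVec : ∀ {d} → Vec Carrier d → Set (c ⊔ ℓ)
  IsZeroVec = VAll (λ z → z ≈ 0#)

  vanishing-term : ∀ {a} x s → a ≈ 0# → a * x + s ≈ s
  vanishing-term {a} x s a≈0 = begin
    a * x + s  ≈⟨ +-congʳ (*-congʳ a≈0) ⟩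
    0# * x + s ≈⟨ +-congʳ (zeroˡ x) ⟩
    0# + s     ≈⟨ +-identityˡ s ⟩
    s          ∎

  drop-first : ∀ {d a0 b} (a : Vec Carrier d) x0 x → a0 ≈ 0# → Sol (a0 ∷ a) b (x0 ∷ x) ⇔ Sol a b x
  drop-first a x0 x a0≈0 = mk⇔ (trans (sym (vanishing-term x0 _ a0≈0))) (trans (vanishing-term x0 _ a0≈0))

  solve-linear : ∀ {a y} x s b → y * a ≈ 1# → (a * x + s ≈ b) ⇔ (x ≈ y * (b - s))
  solve-linear {a} {y} x s b ya≈1 = mk⇔ to from
    where
    to : a * x + s ≈ b → x ≈ y * (b - s)
    to ax+s≈b = begin
      x             ≈⟨ *-identityˡ x ⟨
      1# * x        ≈⟨ *-congʳ ya≈1 ⟨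
      (y * a) * x   ≈⟨ *-assoc y a x ⟩
      y * (a * x)   ≈⟨ *-congˡ (x≈z//y (a * x) s b ax+s≈b) ⟩
      y * (b - s)   ∎
    from : x ≈ y * (b - s) → a * x + s ≈ b
    from x≈ = begin
      a * x + s             ≈⟨ +-congʳ (*-congˡ x≈) ⟩
      a * (y * (b - s)) + s ≈⟨ +-congʳ (*-assoc a y (b - s)) ⟨
      (a * y) * (b - s) + s ≈⟨ +-congʳ (*-congʳ (trans (*-comm a y) ya≈1)) ⟩
      1# * (b - s) + s      ≈⟨ +-congʳ (*-identityˡ (b - s)) ⟩
      (b - s) + s           ≈⟨ //-rightDividesˡ s b ⟩
      b                     ∎

  *-cancel-nonzero : ∀ {k u v} → ¬ k ≈ 0# → k * u ≈ k * v → u ≈ v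
  *-cancel-nonzero {k} {u} {v} k≉0 ku≈kv with inverse k k≉0
  ... | z , kz≈1 = begin
    u             ≈⟨ *-identityˡ u ⟨
    1# * u        ≈⟨ *-congʳ zk≈1 ⟨
    (z * k) * u   ≈⟨ *-assoc z k u ⟩
    z * (k * u)   ≈⟨ *-congˡ ku≈kv ⟩
    z * (k * v)   ≈⟨ *-assoc z k v ⟨
    (z * k) * v   ≈⟨ *-congʳ zk≈1 ⟩
    1# * v        ≈⟨ *-identityˡ v ⟩
    v             ∎
    where
    zk≈1 : z * k ≈ 1#
    zk≈1 = trans (*-comm z k) kz≈1

  dot-zero : ∀ {d} {g : Vec Carrier d} → IsZeroVec g → ∀ x → dot F g x ≈ 0#
  dot-zero []           []       = refl
  dot-zero (g0≈0 ∷ g≈0) (x0 ∷ x) = trans (vanishing-term x0 _ g0≈0) (dot-zero g≈0 x)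

  eliminate : ∀ {d} → Carrier → Vec Carrier d → Vec Carrier d → Vec Carrier d
  eliminate k a' a = zipWith (λ u v → u - k * v) a' a

  dot-eliminate : ∀ {d} k (a' a x : Vec Carrier d) → dot F (eliminate k a' a) x ≈ dot F a' x - k * dot F a x
  dot-eliminate k []        []       []       = begin
    0#            ≈⟨ -‿inverseʳ 0# ⟨
    0# - 0#       ≈⟨ +-congˡ (-‿cong (zeroʳ k)) ⟨
    0# - k * 0#   ∎
  dot-eliminate k (u ∷ a') (v ∷ a) (x0 ∷ x) = begin
    (u - k * v) * x0 + dot F (eliminate k a' a) x
      ≈⟨ +-cong (distribʳ x0 u (- (k * v))) (dot-eliminate k a' a x) ⟩
    (u * x0 + - (k * v) * x0) + (S' - k * S)
      ≈⟨ interchange _ _ _ _ ⟩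
    (u * x0 + S') + (- (k * v) * x0 + - (k * S))
      ≈⟨ +-congˡ (+-congʳ (-‿distribˡ-* (k * v) x0)) ⟨
    (u * x0 + S') + (- ((k * v) * x0) + - (k * S))
      ≈⟨ +-congˡ (-‿+-comm _ _) ⟩
    (u * x0 + S') - ((k * v) * x0 + k * S)
      ≈⟨ +-congˡ (-‿cong (+-congʳ (*-assoc k v x0))) ⟩
    (u * x0 + S') - (k * (v * x0) + k * S)
      ≈⟨ +-congˡ (-‿cong (distribˡ k (v * x0) S)) ⟨
    (u * x0 + S') - k * (v * x0 + S)
      ∎
    where
    S  = dot F a x
    S' = dot F a' x

  eliminated-zero : ∀ {d k} {a' a : Vec Carrier d} → k ≈ 0# → IsZeroVec (eliminate k a' a) → IsZeroVec a'
  eliminated-zero {a' = []} {[]} k≈0 [] = []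
  eliminated-zero {k = k} {u ∷ a'} {v ∷ a} k≈0 (e ∷ es) =
    trans (x∙y⁻¹≈ε⇒x≈y u (k * v) e) (trans (*-congʳ k≈0) (zeroˡ v)) ∷ eliminated-zero k≈0 es

  shift-by : ∀ {u v b b'} k → v ≈ b → (u ≈ b') ⇔ (u - k * v ≈ b' - k * b)
  shift-by {u} {v} {b} {b'} k v≈b = mk⇔
    (λ u≈b' → +-cong u≈b' (-‿cong (*-congˡ v≈b)))
    (λ e → +-cancelʳ (- (k * v)) u b' (trans e (+-congˡ (-‿cong (*-congˡ (sym v≈b))))))

  pivot : ∀ {a0 y} a0' → y * a0 ≈ 1# → a0' - (a0' * y) * a0 ≈ 0#
  pivot {a0} {y} a0' ya0≈1 = x≈y⇒x∙y⁻¹≈ε (sym (begin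
    (a0' * y) * a0 ≈⟨ *-assoc a0' y a0 ⟩
    a0' * (y * a0) ≈⟨ *-congˡ ya0≈1 ⟩
    a0' * 1#       ≈⟨ *-identityʳ a0' ⟩
    a0'            ∎))

  eliminate-first : ∀ {d a0 y b b'} a0' (a a' : Vec Carrier d) x0 x → y * a0 ≈ 1# →
                    Sol (a0 ∷ a) b (x0 ∷ x) →
                    Sol (a0' ∷ a') b' (x0 ∷ x) ⇔ Sol (eliminate (a0' * y) a' a) (b' - (a0' * y) * b) x
  eliminate-first {a0 = a0} {y} {b} {b'} a0' a a' x0 x ya0≈1 on-h = mk⇔
    (λ h' → trans (sym first-drops) (trans elim (Equivalence.to (shift-by k on-h) h')))
    (λ g → Equivalence.from (shift-by k on-h) (trans (sym elim) (trans first-drops g)))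
    where
    k = a0' * y
    elim = dot-eliminate k (a0' ∷ a') (a0 ∷ a) (x0 ∷ x)
    first-drops : dot F (eliminate k (a0' ∷ a') (a0 ∷ a)) (x0 ∷ x) ≈ dot F (eliminate k a' a) x
    first-drops = vanishing-term x0 _ (pivot a0' ya0≈1)

  proportional-same : ∀ {d a0 y b b' a0'} {a a' : Vec Carrier d} → y * a0 ≈ 1# → ¬ IsZeroVec (a0' ∷ a') →
                      IsZeroVec (eliminate (a0' * y) a' a) → b' - (a0' * y) * b ≈ 0# →
                      SameSol (a0 ∷ a) b (a0' ∷ a') b'
  proportional-same {a0 = a0} {y} {b} {b'} {a0'} {a} {a'} ya0≈1 a'≉0 rest≈0 e≈0 x =
    (λ h → trans (proportional x) (trans (*-congˡ h) (sym b'≈kb)))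
    , (λ h' → *-cancel-nonzero k≉0 (trans (sym (proportional x)) (trans h' b'≈kb)))
    where
    k = a0' * y
    eliminated≈0 : IsZeroVec (eliminate k (a0' ∷ a') (a0 ∷ a))
    eliminated≈0 = pivot a0' ya0≈1 ∷ rest≈0
    proportional : ∀ x → dot F (a0' ∷ a') x ≈ k * dot F (a0 ∷ a) x
    proportional x = x∙y⁻¹≈ε⇒x≈y _ _ (trans (sym (dot-eliminate k (a0' ∷ a') (a0 ∷ a) x)) (dot-zero eliminated≈0 x))
    b'≈kb : b' ≈ k * b
    b'≈kb = x∙y⁻¹≈ε⇒x≈y b' (k * b) e≈0
    k≉0 : ¬ k ≈ 0#
    k≉0 k≈0 = a'≉0 (eliminated-zero k≈0 eliminated≈0)

module PointCounting {c ℓ : Level} {q : ℕ} (F : FiniteField c ℓ q) where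

  open import Data.Nat using (zero; suc; _+_; _*_; _^_; _≤_; z≤n)
  open import Data.Nat.Tactic.RingSolver using (solve-∀)
  open import Data.List.Relation.Unary.Any using (Any; any?)
  open import Data.Vec.Relation.Unary.All using (all?)
  open ≡ using (refl; cong)
  open Counting
  open FieldAlgebra F
  open FiniteField F
    using (Carrier; _≈_; _≟_; 0#; 1#; inverse; enum; enum-surj; enum-inj)
    renaming (_*_ to _*ᶠ_; _-_ to _-ᶠ_; *-comm to *ᶠ-comm; trans to ≈-trans; sym to ≈-sym)

  sol? : ∀ {d} (a : Vec Carrier d) b x → Dec (Sol a b x)
  sol? a b x = dot F a x ≟ b

  #Sol : ∀ {d} → Vec Carrier d → Carrier → ℕ
  #Sol {d} a b = count (sol? a b) (points F d)

  #Sol₂ : ∀ {d} → Vec Carrier d → Carrier → Vec Carrier d → Carrier → ℕ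
  #Sol₂ {d} a b a' b' = ∑[ x ∈ points F d ] (𝟙 (sol? a b x) * 𝟙 (sol? a' b' x))

  ∑-elems-const : ∀ k → ∑[ _ ∈ elems F ] k ≡ q * k
  ∑-elems-const k = ≡.trans (∑-const (elems F) k) (cong (_* k) (List.length-tabulate enum))

  ∑-points-suc : ∀ d (g : Vec Carrier (suc d) → ℕ) →
                 ∑ (points F (suc d)) g ≡ ∑[ x0 ∈ elems F ] ∑[ x ∈ points F d ] g (x0 ∷ x)
  ∑-points-suc d g = ≡.trans (∑-concatMap (elems F) (λ x0 → map (x0 ∷_) (points F d)) g)
                             (∑-cong (elems F) (λ x0 → ∑-map (points F d) (x0 ∷_) g))

  ∑-points-drop : ∀ d (g : Vec Carrier (suc d) → ℕ) (h : Vec Carrier d → ℕ) →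
                  (∀ x0 x → g (x0 ∷ x) ≡ h x) → ∑ (points F (suc d)) g ≡ q * ∑ (points F d) h
  ∑-points-drop d g h g≡h = ≡.trans (∑-points-suc d g)
    (≡.trans (∑-cong (elems F) (λ x0 → ∑-cong (points F d) (g≡h x0))) (∑-elems-const _))

  #points : ∀ d → length (points F d) ≡ q ^ d
  #points zero    = refl
  #points (suc d) = begin
    length (points F (suc d))             ≡⟨ ℕ.*-identityʳ _ ⟨
    length (points F (suc d)) * 1         ≡⟨ ∑-const (points F (suc d)) 1 ⟨
    ∑[ _ ∈ points F (suc d) ] 1           ≡⟨ ∑-points-drop d _ _ (λ _ _ → refl) ⟩
    q * ∑[ _ ∈ points F d ] 1             ≡⟨ cong (q *_) (∑-const (points F d) 1) ⟩
    q * (length (points F d) * 1)         ≡⟨ cong (λ n → q * n) (ℕ.*-identityʳ _) ⟩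
    q * length (points F d)               ≡⟨ cong (q *_) (#points d) ⟩
    q * q ^ d                             ∎
    where open ≡.≡-Reasoning

  count-elems-unique : ∀ {p} {P : Pred Carrier p} (P? : ∀ x → Dec (P x)) r →
                       (∀ x → P x ⇔ x ≈ r) → count P? (elems F) ≡ 1
  count-elems-unique P? r P⇔≈r with enum-surj r
  ... | i , enum-i≈r = count-tabulate-unique P? enum i (Equivalence.from (P⇔≈r (enum i)) enum-i≈r)
    (λ j pj → enum-inj j i (≈-trans (Equivalence.to (P⇔≈r (enum j)) pj) (≈-sym enum-i≈r)))

  -- once the first variable is pivotal, every x ∈ F^d extends to exactly one solution
  #Sol-pivot : ∀ d {a0 y} (a : Vec Carrier d) b → y *ᶠ a0 ≈ 1# → #Sol (a0 ∷ a) b ≡ q ^ d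
  #Sol-pivot d a b ya0≈1 = begin
    #Sol (_ ∷ a) b                                                ≡⟨ ∑-points-suc d _ ⟩
    ∑[ x0 ∈ elems F ] ∑[ x ∈ points F d ] 𝟙 (sol? (_ ∷ a) b (x0 ∷ x)) ≡⟨ ∑-swap (elems F) (points F d) _ ⟩
    ∑[ x ∈ points F d ] count (λ x0 → sol? (_ ∷ a) b (x0 ∷ x)) (elems F)
      ≡⟨ ∑-cong (points F d) (λ x → count-elems-unique _ _ (λ x0 → solve-linear x0 (dot F a x) b ya0≈1)) ⟩
    ∑[ _ ∈ points F d ] 1                                          ≡⟨ ∑-const (points F d) 1 ⟩
    length (points F d) * 1                                        ≡⟨ ℕ.*-identityʳ _ ⟩
    length (points F d)                                            ≡⟨ #points d ⟩
    q ^ d                                                          ∎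
    where open ≡.≡-Reasoning

  #Sol-size : ∀ d (a : Vec Carrier d) b → ¬ IsZeroVec a → q * #Sol a b ≡ q ^ d
  #Sol-size zero    []       b a≉0 = ⊥-elim (a≉0 [])
  #Sol-size (suc d) (a0 ∷ a) b a≉0 with a0 ≟ 0#
  ... | yes a0≈0 = cong (q *_) (≡.trans (∑-points-drop d _ _ same-indicator) (#Sol-size d a b (a≉0 ∘ (a0≈0 ∷_))))
    where
    same-indicator : ∀ x0 x → 𝟙 (sol? (a0 ∷ a) b (x0 ∷ x)) ≡ 𝟙 (sol? a b x)
    same-indicator x0 x = 𝟙-⇔ (sol? (a0 ∷ a) b (x0 ∷ x)) (sol? a b x) (drop-first a x0 x a0≈0)
  ... | no a0≉0 with inverse a0 a0≉0
  ...   | y , a0y≈1 = cong (q *_) (#Sol-pivot d a b (≈-trans (*ᶠ-comm y a0) a0y≈1))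

  #Sol₂-sym : ∀ {d} (a : Vec Carrier d) b a' b' → #Sol₂ a b a' b' ≡ #Sol₂ a' b' a b
  #Sol₂-sym {d} a b a' b' = ∑-cong (points F d) (λ x → ℕ.*-comm (𝟙 (sol? a b x)) (𝟙 (sol? a' b' x)))

  #Sol₂-diag : ∀ {d} (a : Vec Carrier d) b → #Sol₂ a b a b ≡ #Sol a b
  #Sol₂-diag {d} a b = ∑-cong (points F d) (λ x → 𝟙-idem (sol? a b x))

  #Sol₂-pivot : ∀ d {a0 y} a0' (a a' : Vec Carrier d) b b' → y *ᶠ a0 ≈ 1# →
                #Sol₂ (a0 ∷ a) b (a0' ∷ a') b' ≡ #Sol (eliminate (a0' *ᶠ y) a' a) (b' -ᶠ (a0' *ᶠ y) *ᶠ b)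
  #Sol₂-pivot d {a0} {y} a0' a a' b b' ya0≈1 =
    ≡.trans (∑-points-suc d _) (≡.trans (∑-swap (elems F) (points F d) _) (∑-cong (points F d) fibre))
    where
    G = eliminate (a0' *ᶠ y) a' a
    e = b' -ᶠ (a0' *ᶠ y) *ᶠ b
    fibre : ∀ x → ∑[ x0 ∈ elems F ] (𝟙 (sol? (a0 ∷ a) b (x0 ∷ x)) * 𝟙 (sol? (a0' ∷ a') b' (x0 ∷ x))) ≡ 𝟙 (sol? G e x)
    fibre x = begin
      ∑[ x0 ∈ elems F ] (𝟙 (sol? (a0 ∷ a) b (x0 ∷ x)) * 𝟙 (sol? (a0' ∷ a') b' (x0 ∷ x)))
        ≡⟨ ∑-cong (elems F) (λ x0 → 𝟙-*-cong (sol? (a0 ∷ a) b (x0 ∷ x)) _ (sol? G e x)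
                                              (eliminate-first a0' a a' x0 x ya0≈1)) ⟩
      ∑[ x0 ∈ elems F ] (𝟙 (sol? (a0 ∷ a) b (x0 ∷ x)) * 𝟙 (sol? G e x))
        ≡⟨ ∑-*ʳ (elems F) _ _ ⟩
      count (λ x0 → sol? (a0 ∷ a) b (x0 ∷ x)) (elems F) * 𝟙 (sol? G e x)
        ≡⟨ cong (_* 𝟙 (sol? G e x)) (count-elems-unique _ _ (λ x0 → solve-linear x0 (dot F a x) b ya0≈1)) ⟩
      1 * 𝟙 (sol? G e x)
        ≡⟨ ℕ.*-identityˡ _ ⟩
      𝟙 (sol? G e x)
        ∎
      where open ≡.≡-Reasoning

  pivot-bound : ∀ d {a0 a0'} (a a' : Vec Carrier d) b b' → ¬ a0 ≈ 0# → ¬ IsZeroVec (a0' ∷ a') →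
                ¬ SameSol (a0 ∷ a) b (a0' ∷ a') b' → q * q * #Sol₂ (a0 ∷ a) b (a0' ∷ a') b' ≤ q ^ suc d
  pivot-bound d {a0} {a0'} a a' b b' a0≉0 a'≉0 distinct with inverse a0 a0≉0
  ... | y , a0y≈1 = ≡.subst (λ n → q * q * n ≤ q ^ suc d) (≡.sym (#Sol₂-pivot d a0' a a' b b' ya0≈1)) reduced
    where
    ya0≈1 = ≈-trans (*ᶠ-comm y a0) a0y≈1
    G = eliminate (a0' *ᶠ y) a' a
    e = b' -ᶠ (a0' *ᶠ y) *ᶠ b
    reduced : q * q * #Sol G e ≤ q ^ suc d
    reduced with all? (_≟ 0#) G
    ... | no G≉0  = ℕ.≤-reflexive (≡.trans (ℕ.*-assoc q q _) (cong (q *_) (#Sol-size d G e G≉0)))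
    ... | yes G≈0 with e ≟ 0#
    ...   | yes e≈0 = ⊥-elim (distinct (proportional-same ya0≈1 a'≉0 G≈0 e≈0))
    ...   | no e≉0  = ℕ.≤-trans (ℕ.≤-reflexive (≡.trans (cong (q * q *_) no-solution) (ℕ.*-zeroʳ (q * q)))) z≤n
      where
      no-solution : #Sol G e ≡ 0
      no-solution = count-none (sol? G e) (All.universal (λ x Gx≈e → e≉0 (≈-trans (≈-sym Gx≈e) (dot-zero G≈0 x))) (points F d))

  #Sol₂-bound : ∀ d (a : Vec Carrier d) b a' b' → ¬ IsZeroVec a → ¬ IsZeroVec a' →
                ¬ SameSol a b a' b' → q * q * #Sol₂ a b a' b' ≤ q ^ d
  #Sol₂-bound zero    []       b []         b' a≉0 a'≉0 distinct = ⊥-elim (a≉0 [])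
  #Sol₂-bound (suc d) (a0 ∷ a) b (a0' ∷ a') b' a≉0 a'≉0 distinct with a0 ≟ 0# | a0' ≟ 0#
  ... | no a0≉0  | _         = pivot-bound d a a' b b' a0≉0 a'≉0 distinct
  ... | yes _    | no a0'≉0  =
    ≡.subst (λ n → q * q * n ≤ q ^ suc d) (#Sol₂-sym (a0' ∷ a') b' (a0 ∷ a) b)
      (pivot-bound d a' a b' b a0'≉0 a≉0 (distinct ∘ SameSol-sym (a0' ∷ a') b' (a0 ∷ a) b))
  ... | yes a0≈0 | yes a0'≈0 = begin
    q * q * #Sol₂ (a0 ∷ a) b (a0' ∷ a') b'  ≡⟨ cong (q * q *_) (∑-points-drop d _ _ same-indicators) ⟩
    q * q * (q * #Sol₂ a b a' b')           ≡⟨ reassociate q (#Sol₂ a b a' b') ⟩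
    q * (q * q * #Sol₂ a b a' b')           ≤⟨ ℕ.*-monoʳ-≤ q (#Sol₂-bound d a b a' b' (a≉0 ∘ (a0≈0 ∷_))
                                                  (a'≉0 ∘ (a0'≈0 ∷_)) (distinct ∘ extend)) ⟩
    q * q ^ d                               ∎
    where
    open ℕ.≤-Reasoning
    reassociate : ∀ q n → q * q * (q * n) ≡ q * (q * q * n)
    reassociate = solve-∀
    same-indicators : ∀ x0 x → 𝟙 (sol? (a0 ∷ a) b (x0 ∷ x)) * 𝟙 (sol? (a0' ∷ a') b' (x0 ∷ x))
                               ≡ 𝟙 (sol? a b x) * 𝟙 (sol? a' b' x)
    same-indicators x0 x = ≡.cong₂ _*_
      (𝟙-⇔ (sol? (a0 ∷ a) b (x0 ∷ x)) (sol? a b x) (drop-first a x0 x a0≈0))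
      (𝟙-⇔ (sol? (a0' ∷ a') b' (x0 ∷ x)) (sol? a' b' x) (drop-first a' x0 x a0'≈0))
    extend : SameSol a b a' b' → SameSol (a0 ∷ a) b (a0' ∷ a') b'
    extend same (x0 ∷ x) =
      (λ h → Equivalence.from (drop-first a' x0 x a0'≈0) (proj₁ (same x) (Equivalence.to (drop-first a x0 x a0≈0) h)))
      , (λ h' → Equivalence.from (drop-first a x0 x a0≈0) (proj₂ (same x) (Equivalence.to (drop-first a' x0 x a0'≈0) h')))

  open Hyperplane using (normal; normal≢0; offset)

  incidences : ∀ {d} → List (Hyperplane F d) → Vec Carrier d → ℕ
  incidences H y = count (_∈H?_ F y) H

  -- each hyperplane has q^(d-1) points, so the incidences sum to |H|·q^(d-1)
  first-moment : ∀ d (H : List (Hyperplane F d)) →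
                 q * ∑[ y ∈ points F d ] incidences H y ≡ length H * q ^ d
  first-moment d H = begin
    q * ∑[ y ∈ points F d ] ∑[ h ∈ H ] 𝟙 (_∈H?_ F y h)  ≡⟨ cong (q *_) (∑-swap (points F d) H _) ⟩
    q * ∑[ h ∈ H ] #Sol (normal h) (offset h)           ≡⟨ ∑-*ˡ H q _ ⟨
    ∑[ h ∈ H ] (q * #Sol (normal h) (offset h))         ≡⟨ ∑-cong H (λ h → #Sol-size d (normal h) (offset h) (normal≢0 h)) ⟩
    ∑[ _ ∈ H ] (q ^ d)                                  ≡⟨ ∑-const H (q ^ d) ⟩
    length H * q ^ d                                    ∎
    where open ≡.≡-Reasoning

  -- distinct hyperplanes share at most q^(d-2) points, so the squared incidences sum to
  -- at most |H|·q^(d-1) (diagonal) plus |H|²·q^(d-2) (off-diagonal)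
  second-moment-bound : ∀ d (H : List (Hyperplane F d)) → DistinctHyperplanes F H →
                        q * q * ∑[ y ∈ points F d ] (incidences H y * incidences H y)
                          ≤ length H * (q * q ^ d) + length H * length H * q ^ d
  second-moment-bound d H distinct = begin
    q * q * ∑[ y ∈ points F d ] (incidences H y * incidences H y)
      ≡⟨ cong (q * q *_) (∑-square (points F d) H (λ h y → 𝟙 (_∈H?_ F y h))) ⟩
    q * q * ∑[ h ∈ H ] ∑[ h' ∈ H ] meet h h'
      ≡⟨ ∑-*ˡ H (q * q) _ ⟨
    ∑[ h ∈ H ] (q * q * ∑[ h' ∈ H ] meet h h')
      ≡⟨ ∑-cong H (λ h → ∑-*ˡ H (q * q) (meet h)) ⟨
    ∑[ h ∈ H ] ∑[ h' ∈ H ] (q * q * meet h h')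
      ≤⟨ ∑∑-bound (λ h h' → q * q * meet h h') diagonal off-diagonal off-diagonal-swapped distinct ⟩
    length H * (q * q ^ d) + length H * length H * q ^ d
      ∎
    where
    open ℕ.≤-Reasoning
    meet : Hyperplane F d → Hyperplane F d → ℕ
    meet h h' = #Sol₂ (normal h) (offset h) (normal h') (offset h')
    diagonal : ∀ h → q * q * meet h h ≤ q * q ^ d
    diagonal h = ℕ.≤-reflexive (≡.trans (cong (q * q *_) (#Sol₂-diag (normal h) (offset h)))
                 (≡.trans (ℕ.*-assoc q q _) (cong (q *_) (#Sol-size d (normal h) (offset h) (normal≢0 h)))))
    off-diagonal : ∀ h h' → ¬ SameHyperplane F h h' → q * q * meet h h' ≤ q ^ d
    off-diagonal h h' = #Sol₂-bound d (normal h) (offset h) (normal h') (offset h') (normal≢0 h) (normal≢0 h')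
    off-diagonal-swapped : ∀ h h' → ¬ SameHyperplane F h h' → q * q * meet h' h ≤ q ^ d
    off-diagonal-swapped h h' h≠h' =
      off-diagonal h' h (h≠h' ∘ SameSol-sym (normal h') (offset h') (normal h) (offset h))

  -- the main estimate: |F^d ∖ ⋃H| · |H| ≤ q^(d+1), by the second moment method
  -- applied to the incidence count, which vanishes exactly off ⋃H
  uncovered-bound : ∀ d (H : List (Hyperplane F d)) .{{_ : NonZero (length H)}} → DistinctHyperplanes F H →
                    uncovered F H * length H ≤ q ^ suc d
  uncovered-bound d H distinct = begin
    uncovered F H * n       ≡⟨ cong (_* n) (length-filter uncovered? (points F d)) ⟩
    count uncovered? (points F d) * n
      ≤⟨ second-moment uncovered? (points F d) (incidences H) n q no-incidence first second ⟩
    q * length (points F d) ≡⟨ cong (q *_) (#points d) ⟩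
    q * q ^ d               ∎
    where
    open ℕ.≤-Reasoning
    n = length H
    uncovered? : ∀ y → Dec (¬ Any (_∈H_ F y) H)
    uncovered? y = ¬? (any? (_∈H?_ F y) H)
    no-incidence : ∀ y → ¬ Any (_∈H_ F y) H → incidences H y ≡ 0
    no-incidence y = count-none (_∈H?_ F y) ∘ ¬Any⇒All¬ H
    first : q * ∑ (points F d) (incidences H) ≡ n * length (points F d)
    first = ≡.trans (first-moment d H) (cong (n *_) (≡.sym (#points d)))
    second : q * q * ∑[ y ∈ points F d ] (incidences H y * incidences H y)
               ≤ n * (q * length (points F d)) + n * n * length (points F d)
    second = ≡.subst (λ N → q * q * ∑[ y ∈ points F d ] (incidences H y * incidences H y) ≤ n * (q * N) + n * n * N)
                     (≡.sym (#points d)) (second-moment-bound d H distinct)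

-- ℕ arithmetic is opened only here, since FieldAlgebra uses the same operator names
open import Data.Nat using (suc; _*_; _^_; _≤_)

lemma1 : ∀ {c ℓ : Level} (q : ℕ) (F : FiniteField c ℓ q) (d : ℕ)
         (H : List (Hyperplane F d)) →
         DistinctHyperplanes F H →
         ¬ (H ≡ []) →
         uncovered F H * length H ≤ q ^ (suc d)
lemma1 q F d []      _        H≢[] = ⊥-elim (H≢[] ≡.refl)
lemma1 q F d (h ∷ H) distinct _    = PointCounting.uncovered-bound F d (h ∷ H) distinct
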